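{- Let $A$ be a $\sigma$-projective set. Then (1) $A$ has a $\sigma$-projective code in which no complements and no basic open sets appear; and (2) $A$ has a $\sigma$-projective code in which no complements and no basic closed sets appear.
   Context: The $\sigma$-projective sets form the smallest pointclass (of subsets of the spaces $(\omega^\omega)^k$, $k\geq1$, with the product topology of discrete $\omega$) containing the open sets and closed under complements, countable unions, and projections. Fix an enumeration $\{A_{n+1}:n\in\omega\}$ of all basic open and basic closed sets in each $(\omega^\omega)^k$, $1\leq k<\omega$. A $\sigma$-projective code $[A]$ of a $\sigma$-projective set $A$ is defined inductively: if $A$ is basic open or basic closed with $A=A_n$, then $[A]=\langle n\rangle$; if $A=\bigcup_i A_i$ then $[A]=\langle [A_0],[A_1],\dots\rangle$; if $A=\bigcap_iA_i$ then $[A]=\langle 0,[A_0],[A_1],\dots\rangle$; if $A=(\omega^\omega)^k\setminus B$ then $[A]=\langle1,[B]\rangle$ (a complement); if $A=p[B]=\{x:\exists y\,(x,y)\in B\}$ then $[A]=\langle 2,[B]\rangle$; if $A=u[B]=\{x:\forall y\in\omega^\omega\,(x,y)\in B\}$ then $[A]=\langle3,[B]\rangle$. A set may have many codes. -}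

module Defs where

open import Data.Nat using (ℕ; zero; suc)
open import Data.Fin using (Fin; zero; suc)
open import Data.List using (List; []; _∷_)
open import Data.Product using (Σ; _×_; _,_)
open import Data.Sum using (_⊎_)
open import Data.Unit using (⊤)
open import Data.Empty using (⊥)
open import Relation.Nullary using (¬_)
open import Relation.Binary.PropositionalEquality using (_≡_)
open import Function.Bundles using (_⇔_)

Baire : Set
Baire = ℕ → ℕ

-- A point of (ω^ω)^(suc n); the index n codes dimension k = n + 1 ≥ 1.
Point : ℕ → Set
Point n = Fin (suc n) → Baire

Subset : ℕ → Set₁
Subset n = Point n → Set

Prefix : List ℕ → Baire → Set
Prefix [] x = ⊤
Prefix (a ∷ s) x = (x 0 ≡ a) × Prefix s (λ j → x (suc j))

-- Basic open set of (ω^ω)^(suc n): a product N_{s_0} × … × N_{s_n}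
-- given by a tuple of finite sequences.
BasicIndex : ℕ → Set
BasicIndex n = Fin (suc n) → List ℕ

inBasic : ∀ {n} → BasicIndex n → Point n → Set
inBasic s x = ∀ i → Prefix (s i) (x i)

appendLast : ∀ {m} {B : Set} → (Fin m → B) → B → Fin (suc m) → B
appendLast {zero} x y zero = y
appendLast {suc m} x y zero = x zero
appendLast {suc m} x y (suc i) = appendLast (λ j → x (suc j)) y i

data Code : ℕ → Set where
  bopen   : ∀ {n} → BasicIndex n → Code n
  bclosed : ∀ {n} → BasicIndex n → Code n
  union   : ∀ {n} → (ℕ → Code n) → Code n
  inter   : ∀ {n} → (ℕ → Code n) → Code n
  compl   : ∀ {n} → Code n → Code n
  proj    : ∀ {n} → Code (suc n) → Code n
  uproj   : ∀ {n} → Code (suc n) → Code n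

⟦_⟧ : ∀ {n} → Code n → Subset n
⟦ bopen s ⟧ x = inBasic s x
⟦ bclosed s ⟧ x = ¬ inBasic s x
⟦ union c ⟧ x = Σ ℕ λ i → ⟦ c i ⟧ x
⟦ inter c ⟧ x = ∀ i → ⟦ c i ⟧ x
⟦ compl c ⟧ x = ¬ ⟦ c ⟧ x
⟦ proj c ⟧ x = Σ Baire λ y → ⟦ c ⟧ (appendLast x y)
⟦ uproj c ⟧ x = ∀ (y : Baire) → ⟦ c ⟧ (appendLast x y)

Codes : ∀ {n} → Code n → Subset n → Set
Codes c A = ∀ x → ⟦ c ⟧ x ⇔ A x

IsSigmaProjective : ∀ {n} → Subset n → Set
IsSigmaProjective {n} A = Σ (Code n) λ c → Codes c A

NoComplNoOpen : ∀ {n} → Code n → Set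
NoComplNoOpen (bopen s) = ⊥
NoComplNoOpen (bclosed s) = ⊤
NoComplNoOpen (union c) = ∀ i → NoComplNoOpen (c i)
NoComplNoOpen (inter c) = ∀ i → NoComplNoOpen (c i)
NoComplNoOpen (compl c) = ⊥
NoComplNoOpen (proj c) = NoComplNoOpen c
NoComplNoOpen (uproj c) = NoComplNoOpen c

NoComplNoClosed : ∀ {n} → Code n → Set
NoComplNoClosed (bopen s) = ⊤
NoComplNoClosed (bclosed s) = ⊥
NoComplNoClosed (union c) = ∀ i → NoComplNoClosed (c i)
NoComplNoClosed (inter c) = ∀ i → NoComplNoClosed (c i)
NoComplNoClosed (compl c) = ⊥
NoComplNoClosed (proj c) = NoComplNoClosed c
NoComplNoClosed (uproj c) = NoComplNoClosed c

-- Classically, complements can be pushed down to the basic sets by De Morgan's laws, at the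
-- price of swapping unions with intersections, p with u, and basic open with basic closed
-- sets. So it suffices to write every basic open set as a countable intersection of basic
-- closed sets, and every basic closed set as a countable union of basic open sets. Both come
-- from one observation: a sequence y fails to extend s iff it extends one of the countably many
-- deviations s↾j ⌢ b with j < |s| and b ≠ s j, each of which is a basic open set.

module Submission where

open import Defs
open import Data.Nat using (ℕ; zero; suc; _≟_)
open import Data.Nat.DivMod using (_mod_; m<n⇒m%n≡m)
open import Data.Fin as Fin using (Fin; toℕ)
open import Data.Fin.Properties using (toℕ<n; fromℕ<-cong; fromℕ<-toℕ)
open import Data.List using (List; []; _∷_)
open import Data.Maybe as Maybe using (Maybe; just; nothing)
open import Data.Product using (Σ; ∃; ∃₂; _×_; _,_; proj₂)
open import Data.Unit using (tt)
open import Data.Empty using (⊥)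
open import Level using (0ℓ)
open import Function using (_∘_)
open import Function.Bundles using (_⇔_; mk⇔; Equivalence)
open import Function.Properties.Equivalence using (⇔-setoid)
open import Function.Construct.Symmetry using (⇔-sym)
open import Function.Construct.Identity using (⇔-id)
open import Function.Construct.Composition using (_⇔-∘_)
open import Function.Related.TypeIsomorphisms using (¬-cong-⇔)
open import Axiom.ExcludedMiddle using (ExcludedMiddle)
open import Axiom.DoubleNegationElimination using (em⇒dne)
open import Relation.Nullary using (¬_; yes; no)
open import Relation.Nullary.Negation using (¬∃⟶∀¬; contradiction)
open import Relation.Binary.PropositionalEquality using (_≡_; refl; sym; trans; subst)
import Relation.Binary.Reasoning.Setoid as SetoidReasoning

open Equivalence using (to; from)
open SetoidReasoning (⇔-setoid 0ℓ)

∀-cong-⇔ : {I : Set} {P Q : I → Set} → (∀ i → P i ⇔ Q i) → (∀ i → P i) ⇔ (∀ i → Q i)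
∀-cong-⇔ P⇔Q = mk⇔ (λ p i → to (P⇔Q i) (p i)) (λ q i → from (P⇔Q i) (q i))

∃-cong-⇔ : {I : Set} {P Q : I → Set} → (∀ i → P i ⇔ Q i) → ∃ P ⇔ ∃ Q
∃-cong-⇔ P⇔Q = mk⇔ (λ (i , p) → i , to (P⇔Q i) p) (λ (i , q) → i , from (P⇔Q i) q)

∀-cong-¬∃ : {I : Set} {P Q : I → Set} → (∀ i → Q i ⇔ (¬ P i)) → (∀ i → Q i) ⇔ (¬ ∃ P)
∀-cong-¬∃ Q⇔¬P = mk⇔ (λ q (i , p) → to (Q⇔¬P i) (q i) p)
                     (λ ¬∃ i → from (Q⇔¬P i) (¬∃⟶∀¬ ¬∃ i))

∃-mod⇔∃ : ∀ {n} {P : Fin (suc n) → Set} → (∃ λ k → P (k mod suc n)) ⇔ ∃ P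
∃-mod⇔∃ {n} {P} =
  mk⇔ (λ (k , p) → k mod suc n , p) (λ (i , p) → toℕ i , subst P (sym (toℕ-mod i)) p)
  where
  toℕ-mod : (i : Fin (suc n)) → toℕ i mod suc n ≡ i
  toℕ-mod i =
    trans (fromℕ<-cong _ _ (m<n⇒m%n≡m (toℕ<n i)) _ (toℕ<n i)) (fromℕ<-toℕ i (toℕ<n i))

PrefixMaybe : Maybe (List ℕ) → Baire → Set
PrefixMaybe nothing  y = ⊥
PrefixMaybe (just u) y = Prefix u y

PrefixMaybe-map-∷ : ∀ a m (y : Baire) →
  PrefixMaybe (Maybe.map (a ∷_) m) y ⇔ (y 0 ≡ a × PrefixMaybe m (y ∘ suc))
PrefixMaybe-map-∷ a nothing  y = mk⇔ (λ ()) (λ ())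
PrefixMaybe-map-∷ a (just u) y = ⇔-id _

deviation : List ℕ → ℕ → ℕ → Maybe (List ℕ)
deviation []      j       b = nothing
deviation (a ∷ s) zero    b with b ≟ a
... | yes _ = nothing
... | no  _ = just (b ∷ [])
deviation (a ∷ s) (suc j) b = Maybe.map (a ∷_) (deviation s j b)

deviation-here : ∀ {a b} s → ¬ b ≡ a → deviation (a ∷ s) 0 b ≡ just (b ∷ [])
deviation-here {a} {b} s b≢a with b ≟ a
... | yes b≡a = contradiction b≡a b≢a
... | no _    = refl

deviation-excludes : ∀ s j b y → PrefixMaybe (deviation s j b) y → ¬ Prefix s y
deviation-excludes (a ∷ s) zero b y dev (y0≡a , _) with b ≟ a | dev
... | no b≢a | y0≡b , _ = b≢a (trans (sym y0≡b) y0≡a)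
deviation-excludes (a ∷ s) (suc j) b y dev (_ , ys) =
  deviation-excludes s j b (y ∘ suc) (proj₂ (to (PrefixMaybe-map-∷ a (deviation s j b) y) dev)) ys

deviation-exists : ∀ s y → ¬ Prefix s y → ∃₂ λ j b → PrefixMaybe (deviation s j b) y
deviation-exists []      y ¬pre = contradiction tt ¬pre
deviation-exists (a ∷ s) y ¬pre with y 0 ≟ a
... | no y0≢a = 0 , y 0 , subst (λ m → PrefixMaybe m y) (sym (deviation-here s y0≢a)) (refl , tt)
... | yes y0≡a with deviation-exists s (y ∘ suc) (λ ys → ¬pre (y0≡a , ys))
...   | j , b , dev = suc j , b , from (PrefixMaybe-map-∷ a (deviation s j b) y) (y0≡a , dev)

¬Prefix⇔deviates : ∀ s y → (¬ Prefix s y) ⇔ (∃₂ λ j b → PrefixMaybe (deviation s j b) y)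
¬Prefix⇔deviates s y =
  mk⇔ (deviation-exists s y) (λ (j , b , dev) → deviation-excludes s j b y dev)

cylinder : ∀ {n} → Fin (suc n) → List ℕ → BasicIndex n
cylinder i u j with i Fin.≟ j
... | yes _ = u
... | no  _ = []

cylinder-self : ∀ {n} (i : Fin (suc n)) u → cylinder i u i ≡ u
cylinder-self i u with i Fin.≟ i
... | yes _   = refl
... | no  i≢i = contradiction refl i≢i

inBasic-cylinder : ∀ {n} (i : Fin (suc n)) u (x : Point n) →
  inBasic (cylinder i u) x ⇔ Prefix u (x i)
inBasic-cylinder i u x =
  mk⇔ (λ pre → subst (λ v → Prefix v (x i)) (cylinder-self i u) (pre i)) elsewhere
  where
  elsewhere : Prefix u (x i) → inBasic (cylinder i u) x
  elsewhere pre j with i Fin.≟ j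
  ... | yes refl = pre
  ... | no  _    = tt

empty : ∀ {n} → Code n
empty = inter λ k → bopen (cylinder Fin.zero (k ∷ []))

empty-sound : ∀ {n} (x : Point n) → ¬ ⟦ empty ⟧ x
empty-sound x all with to (inBasic-cylinder Fin.zero (0 ∷ []) x) (all 0)
                     | to (inBasic-cylinder Fin.zero (1 ∷ []) x) (all 1)
... | x₀≡0 , _ | x₀≡1 , _ with trans (sym x₀≡0) x₀≡1
... | ()

meet : ∀ {n} → Fin (suc n) → Maybe (List ℕ) → Code n
meet i nothing  = empty
meet i (just u) = bopen (cylinder i u)

meet-sound : ∀ {n} (i : Fin (suc n)) m x → ⟦ meet i m ⟧ x ⇔ PrefixMaybe m (x i)
meet-sound i nothing  x = mk⇔ (empty-sound x) (λ ())
meet-sound i (just u) x = inBasic-cylinder i u x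

basicComplement : ∀ {n} → BasicIndex n → Code n
basicComplement {n} s = union λ k → union λ j → union λ b →
  let i = k mod suc n in meet i (deviation (s i) j b)

basicComplement⇔∃¬Prefix : ∀ {n} (s : BasicIndex n) x →
  ⟦ basicComplement s ⟧ x ⇔ (∃ λ i → ¬ Prefix (s i) (x i))
basicComplement⇔∃¬Prefix {n} s x = begin
  ⟦ basicComplement s ⟧ x
    ≈⟨ ∃-cong-⇔ (λ k → ∃-cong-⇔ λ j → ∃-cong-⇔ λ b → meet-sound (k mod suc n) _ x) ⟩
  (∃ λ k → ∃₂ λ j b → PrefixMaybe (deviation (s (k mod suc n)) j b) (x (k mod suc n)))
    ≈⟨ ∃-cong-⇔ (λ k → ⇔-sym (¬Prefix⇔deviates (s (k mod suc n)) (x (k mod suc n)))) ⟩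
  (∃ λ k → ¬ Prefix (s (k mod suc n)) (x (k mod suc n)))
    ≈⟨ ∃-mod⇔∃ ⟩
  (∃ λ i → ¬ Prefix (s i) (x i)) ∎

basicComplement-NoComplNoClosed : ∀ {n} (s : BasicIndex n) → NoComplNoClosed (basicComplement s)
basicComplement-NoComplNoClosed {n} s k j b with deviation (s (k mod suc n)) j b
... | nothing = λ _ → tt
... | just _  = tt

dual : ∀ {n} → Code n → Code n
dual (bopen s)   = bclosed s
dual (bclosed s) = bopen s
dual (union c)   = inter (dual ∘ c)
dual (inter c)   = union (dual ∘ c)
dual (compl c)   = compl (dual c)
dual (proj c)    = uproj (dual c)
dual (uproj c)   = proj (dual c)

dual-NoComplNoClosed : ∀ {n} (c : Code n) → NoComplNoClosed c → NoComplNoOpen (dual c)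
dual-NoComplNoClosed (bopen s) _  = tt
dual-NoComplNoClosed (union c) h  = λ i → dual-NoComplNoClosed (c i) (h i)
dual-NoComplNoClosed (inter c) h  = λ i → dual-NoComplNoClosed (c i) (h i)
dual-NoComplNoClosed (proj c) h   = dual-NoComplNoClosed c h
dual-NoComplNoClosed (uproj c) h  = dual-NoComplNoClosed c h

dual-NoComplNoOpen : ∀ {n} (c : Code n) → NoComplNoOpen c → NoComplNoClosed (dual c)
dual-NoComplNoOpen (bclosed s) _ = tt
dual-NoComplNoOpen (union c) h   = λ i → dual-NoComplNoOpen (c i) (h i)
dual-NoComplNoOpen (inter c) h   = λ i → dual-NoComplNoOpen (c i) (h i)
dual-NoComplNoOpen (proj c) h    = dual-NoComplNoOpen c h
dual-NoComplNoOpen (uproj c) h   = dual-NoComplNoOpen c h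

withoutOpen withoutClosed : ∀ {n} → Code n → Code n
withoutOpen (bopen s)     = dual (basicComplement s)
withoutOpen (bclosed s)   = bclosed s
withoutOpen (union c)     = union (withoutOpen ∘ c)
withoutOpen (inter c)     = inter (withoutOpen ∘ c)
withoutOpen (compl c)     = dual (withoutClosed c)
withoutOpen (proj c)      = proj (withoutOpen c)
withoutOpen (uproj c)     = uproj (withoutOpen c)
withoutClosed (bopen s)   = bopen s
withoutClosed (bclosed s) = basicComplement s
withoutClosed (union c)   = union (withoutClosed ∘ c)
withoutClosed (inter c)   = inter (withoutClosed ∘ c)
withoutClosed (compl c)   = dual (withoutOpen c)
withoutClosed (proj c)    = proj (withoutClosed c)
withoutClosed (uproj c)   = uproj (withoutClosed c)

withoutOpen-NoComplNoOpen : ∀ {n} (c : Code n) → NoComplNoOpen (withoutOpen c)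
withoutClosed-NoComplNoClosed : ∀ {n} (c : Code n) → NoComplNoClosed (withoutClosed c)
withoutOpen-NoComplNoOpen (bopen s)   =
  dual-NoComplNoClosed (basicComplement s) (basicComplement-NoComplNoClosed s)
withoutOpen-NoComplNoOpen (bclosed s) = tt
withoutOpen-NoComplNoOpen (union c)   = withoutOpen-NoComplNoOpen ∘ c
withoutOpen-NoComplNoOpen (inter c)   = withoutOpen-NoComplNoOpen ∘ c
withoutOpen-NoComplNoOpen (compl c)   =
  dual-NoComplNoClosed (withoutClosed c) (withoutClosed-NoComplNoClosed c)
withoutOpen-NoComplNoOpen (proj c)    = withoutOpen-NoComplNoOpen c
withoutOpen-NoComplNoOpen (uproj c)   = withoutOpen-NoComplNoOpen c
withoutClosed-NoComplNoClosed (bopen s)   = tt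
withoutClosed-NoComplNoClosed (bclosed s) = basicComplement-NoComplNoClosed s
withoutClosed-NoComplNoClosed (union c)   = withoutClosed-NoComplNoClosed ∘ c
withoutClosed-NoComplNoClosed (inter c)   = withoutClosed-NoComplNoClosed ∘ c
withoutClosed-NoComplNoClosed (compl c)   =
  dual-NoComplNoOpen (withoutOpen c) (withoutOpen-NoComplNoOpen c)
withoutClosed-NoComplNoClosed (proj c)    = withoutClosed-NoComplNoClosed c
withoutClosed-NoComplNoClosed (uproj c)   = withoutClosed-NoComplNoClosed c

module Classical (em : ExcludedMiddle 0ℓ) where

  ¬¬⇔ : {P : Set} → (¬ ¬ P) ⇔ P
  ¬¬⇔ = mk⇔ (em⇒dne em) (λ p ¬p → ¬p p)

  ¬∀⇒∃¬ : {I : Set} {P : I → Set} → ¬ (∀ i → P i) → ∃ λ i → ¬ P i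
  ¬∀⇒∃¬ ¬∀ = em⇒dne em (λ ¬∃ → ¬∀ (λ i → em⇒dne em (¬∃⟶∀¬ ¬∃ i)))

  ∃-cong-¬∀ : {I : Set} {P Q : I → Set} → (∀ i → Q i ⇔ (¬ P i)) → ∃ Q ⇔ (¬ (∀ i → P i))
  ∃-cong-¬∀ Q⇔¬P = mk⇔ (λ (i , q) p → to (Q⇔¬P i) q (p i))
                       (λ ¬∀ → let (i , ¬p) = ¬∀⇒∃¬ ¬∀ in i , from (Q⇔¬P i) ¬p)

  basicComplement-sound : ∀ {n} (s : BasicIndex n) x → ⟦ basicComplement s ⟧ x ⇔ (¬ inBasic s x)
  basicComplement-sound s x = ∃-cong-¬∀ (λ _ → ⇔-id _) ⇔-∘ basicComplement⇔∃¬Prefix s x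

  dual-sound : ∀ {n} (c : Code n) x → ⟦ dual c ⟧ x ⇔ (¬ ⟦ c ⟧ x)
  dual-sound (bopen s)   x = ⇔-id _
  dual-sound (bclosed s) x = ⇔-sym ¬¬⇔
  dual-sound (union c)   x = ∀-cong-¬∃ λ i → dual-sound (c i) x
  dual-sound (inter c)   x = ∃-cong-¬∀ λ i → dual-sound (c i) x
  dual-sound (compl c)   x = ¬-cong-⇔ (dual-sound c x)
  dual-sound (proj c)    x = ∀-cong-¬∃ λ y → dual-sound c (appendLast x y)
  dual-sound (uproj c)   x = ∃-cong-¬∀ λ y → dual-sound c (appendLast x y)

  dual-cong : ∀ {n} (c : Code n) {P : Set} x → ⟦ c ⟧ x ⇔ P → ⟦ dual c ⟧ x ⇔ (¬ P)
  dual-cong c x c⇔P = ¬-cong-⇔ c⇔P ⇔-∘ dual-sound c x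

  withoutOpen-sound : ∀ {n} (c : Code n) x → ⟦ withoutOpen c ⟧ x ⇔ ⟦ c ⟧ x
  withoutClosed-sound : ∀ {n} (c : Code n) x → ⟦ withoutClosed c ⟧ x ⇔ ⟦ c ⟧ x
  withoutOpen-sound (bopen s)   x =
    ¬¬⇔ ⇔-∘ dual-cong (basicComplement s) x (basicComplement-sound s x)
  withoutOpen-sound (bclosed s) x = ⇔-id _
  withoutOpen-sound (union c)   x = ∃-cong-⇔ λ i → withoutOpen-sound (c i) x
  withoutOpen-sound (inter c)   x = ∀-cong-⇔ λ i → withoutOpen-sound (c i) x
  withoutOpen-sound (compl c)   x = dual-cong (withoutClosed c) x (withoutClosed-sound c x)
  withoutOpen-sound (proj c)    x = ∃-cong-⇔ λ y → withoutOpen-sound c (appendLast x y)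
  withoutOpen-sound (uproj c)   x = ∀-cong-⇔ λ y → withoutOpen-sound c (appendLast x y)
  withoutClosed-sound (bopen s)   x = ⇔-id _
  withoutClosed-sound (bclosed s) x = basicComplement-sound s x
  withoutClosed-sound (union c)   x = ∃-cong-⇔ λ i → withoutClosed-sound (c i) x
  withoutClosed-sound (inter c)   x = ∀-cong-⇔ λ i → withoutClosed-sound (c i) x
  withoutClosed-sound (compl c)   x = dual-cong (withoutOpen c) x (withoutOpen-sound c x)
  withoutClosed-sound (proj c)    x = ∃-cong-⇔ λ y → withoutClosed-sound c (appendLast x y)
  withoutClosed-sound (uproj c)   x = ∀-cong-⇔ λ y → withoutClosed-sound c (appendLast x y)

lemma3p3 : ExcludedMiddle 0ℓ → (n : ℕ) (A : Subset n) → IsSigmaProjective A →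
    (Σ (Code n) λ c → NoComplNoOpen c × Codes c A)
      × (Σ (Code n) λ c → NoComplNoClosed c × Codes c A)
lemma3p3 em n A (c , c-codes-A) =
    ( withoutOpen c , withoutOpen-NoComplNoOpen c
    , λ x → c-codes-A x ⇔-∘ withoutOpen-sound c x )
  , ( withoutClosed c , withoutClosed-NoComplNoClosed c
    , λ x → c-codes-A x ⇔-∘ withoutClosed-sound c x )
  where open Classical em
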